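{- Let $\alpha:X\rightharpoonup\wp(Y)$ be a relation and let $f:Y\rightharpoonup\wp(Z)$ and $g:Z\rightharpoonup\wp(W)$ be partial functions. Then $(\alpha*f)*g=\alpha*(f*g)$.
   Context: Relations $\alpha:X\rightharpoonup Y$ are subsets of $X\times Y$ (sets with the axiom of choice); juxtaposition is relational composition; $\sqsubseteq$ inclusion, $\sqcup$ union; $\mathrm{dom}\,\alpha=\{(x,x)\mid\exists y.\,(x,y)\in\alpha\}$; a pfn (partial function) is a univalent relation. For $f:Y\rightharpoonup\wp(Z)$, $(B,A)\in f_\circ$ iff $A=\bigcup\{C\mid\exists b\in B.\,(b,C)\in f\}$. For $v\sqsubseteq\mathrm{id}_Y$, $\hat u_v=\{(A,A)\mid A\subseteq Y,\ \forall a\in A.\,(a,a)\in v\}$. $f\sqsubseteq_c\beta$ means $f\sqsubseteq\beta$, $f$ a pfn, $\mathrm{dom}\,f=\mathrm{dom}\,\beta$. Peleg lifting: $\beta_*=\bigsqcup_{f\sqsubseteq_c\beta}\hat u_{\mathrm{dom}\,\beta}f_\circ$ (set-theoretically, $(B,A)\in\beta_*$ iff there is a function $h$ on $B$ with $(b,h(b))\in\beta$ for all $b\in B$ and $A=\bigcup_{b\in B}h(b)$). Peleg composition: $\alpha*\beta=\alpha\beta_*$. -}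

module Defs where

open import Data.Product using (Σ; Σ-syntax; _×_)

℘ : Set → Set₁
℘ Y = Y → Set

_≐_ : {Y : Set} → ℘ Y → ℘ Y → Set
_≐_ {Y} A B = (y : Y) → (A y → B y) × (B y → A y)

Rel℘ : Set → Set → Set₂
Rel℘ Y Z = Y → ℘ Z → Set₁

⋃ : {Y Z : Set} → ℘ Y → (Y → ℘ Z) → ℘ Z
⋃ {Y} B h z = Σ[ b ∈ Y ] (B b × h b z)

IsPfn : {Y Z : Set} → Rel℘ Y Z → Set₁
IsPfn {Y} {Z} f = (y : Y) (A A′ : ℘ Z) → f y A → f y A′ → A ≐ A′

-- Relation on sets respects set equality (automatic in set theory,
-- where extensionally equal sets are equal).
Respects≐ : {Y Z : Set} → Rel℘ Y Z → Set₁
Respects≐ {Y} {Z} β = (y : Y) (A A′ : ℘ Z) → A ≐ A′ → β y A → β y A′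

-- Peleg lifting  β_* : ℘Y ⇀ ℘Z :
-- (B , A) ∈ β_*  iff there is a function h on B with (b , h b) ∈ β for all
-- b ∈ B and A = ⋃_{b ∈ B} h b.  (h is given on all of Y; only its values
-- on B matter.)
lift* : {Y Z : Set} → Rel℘ Y Z → ℘ Y → ℘ Z → Set₁
lift* {Y} {Z} β B A =
  Σ[ h ∈ (Y → ℘ Z) ] (((b : Y) → B b → β b (h b)) × (A ≐ ⋃ B h))

_⨾_ : {X Y Z : Set} → Rel℘ X Y → (℘ Y → ℘ Z → Set₁) → Rel℘ X Z
_⨾_ {X} {Y} α γ x A = Σ[ B ∈ ℘ Y ] (α x B × γ B A)

_✶_ : {X Y Z : Set} → Rel℘ X Y → Rel℘ Y Z → Rel℘ X Z
α ✶ β = α ⨾ lift* β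

_⊑_ : {X Z : Set} → Rel℘ X Z → Rel℘ X Z → Set₁
_⊑_ {X} {Z} α β = (x : X) (A : ℘ Z) → α x A → β x A

_≡ᴿ_ : {X Z : Set} → Rel℘ X Z → Rel℘ X Z → Set₁
α ≡ᴿ β = (α ⊑ β) × (β ⊑ α)

-- Everything reduces to the functoriality of the Peleg lifting,
-- (f * g)_* = f_* g_*, read off pointwise.  The inclusion f_* g_* ⊑ (f * g)_*
-- holds for arbitrary relations: the witnesses for b ∈ B are composed.  For
-- the converse a witness of (f * g)_* picks, for each b ∈ B, some C_b with
-- (b , C_b) ∈ f and a k_b witnessing (C_b , h b) ∈ g_*; these choices need
-- not agree, but f and g being partial functions makes all choices at the
-- same point equal as sets, so their unions are again values of f and g.
module Submission where

open import Defs
open import Data.Product using (Σ; Σ-syntax; _×_; _,_; proj₁; proj₂)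
open import Function using (id)

≐-refl : {Y : Set} {A : ℘ Y} → A ≐ A
≐-refl _ = id , id

pfn-⋃-value : {I Y Z : Set} {f : Rel℘ Y Z} → IsPfn f → Respects≐ f →
              {y : Y} (F : I → ℘ Z) → ((i : I) → f y (F i)) →
              I → f y (λ z → Σ[ i ∈ I ] F i z)
pfn-⋃-value pf rf {y} F fF i = rf y (F i) _ F-i≐⋃F (fF i)
  where
  F-i≐⋃F : F i ≐ (λ z → Σ[ j ∈ _ ] F j z)
  F-i≐⋃F z = (λ c → i , c)
           , (λ { (j , c) → proj₁ (pf y (F j) (F i) (fF j) (fF i) z) c })

module _ {Y Z W : Set} (f : Rel℘ Y Z) (g : Rel℘ Z W) where

  lift*-compose : {B : ℘ Y} {C : ℘ Z} {A : ℘ W} →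
                  lift* f B C → lift* g C A → lift* (f ✶ g) B A
  lift*-compose {B} {C} {A} (h , fh , C≐) (k , gk , A≐) = m , fgm , A≐⋃Bm
    where
    m : Y → ℘ W
    m b = ⋃ (h b) k

    fgm : (b : Y) → B b → (f ✶ g) b (m b)
    fgm b p = h b , fh b p , k , (λ c hc → gk c (proj₂ (C≐ c) (b , p , hc))) , ≐-refl

    A≐⋃Bm : A ≐ ⋃ B m
    A≐⋃Bm w = to , from
      where
      to : A w → ⋃ B m w
      to aw with proj₁ (A≐ w) aw
      ... | c , Cc , kw with proj₁ (C≐ c) Cc
      ... | b , p , hc = b , p , c , hc , kw
      from : ⋃ B m w → A w
      from (b , p , c , hc , kw) = proj₂ (A≐ w) (c , proj₂ (C≐ c) (b , p , hc) , kw)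

  lift*-split : IsPfn f → Respects≐ f → IsPfn g → Respects≐ g →
                {B : ℘ Y} {A : ℘ W} → lift* (f ✶ g) B A →
                Σ[ C ∈ ℘ Z ] (lift* f B C × lift* g C A)
  lift*-split pf rf pg rg {B} {A} (m , fgm , A≐) =
    ⋃ B h , (h , fh , ≐-refl) , k , gk , A≐⋃Ck
    where
    C-at : (b : Y) → B b → ℘ Z
    C-at b p = proj₁ (fgm b p)
    f-C-at : (b : Y) (p : B b) → f b (C-at b p)
    f-C-at b p = proj₁ (proj₂ (fgm b p))
    k-at : (b : Y) → B b → Z → ℘ W
    k-at b p = proj₁ (proj₂ (proj₂ (fgm b p)))
    g-k-at : (b : Y) (p : B b) (c : Z) → C-at b p c → g c (k-at b p c)
    g-k-at b p = proj₁ (proj₂ (proj₂ (proj₂ (fgm b p))))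
    m≐ : (b : Y) (p : B b) → m b ≐ ⋃ (C-at b p) (k-at b p)
    m≐ b p = proj₂ (proj₂ (proj₂ (proj₂ (fgm b p))))

    h : Y → ℘ Z
    h b z = Σ[ p ∈ B b ] C-at b p z

    fh : (b : Y) → B b → f b (h b)
    fh b = pfn-⋃-value pf rf (C-at b) (f-C-at b)

    k : Z → ℘ W
    k c w = Σ[ (b , p , _) ∈ Σ[ b ∈ Y ] Σ[ p ∈ B b ] C-at b p c ] k-at b p c w

    gk : (c : Z) → ⋃ B h c → g c (k c)
    gk c (b , _ , p , Cc) =
      pfn-⋃-value pg rg _ (λ { (b′ , p′ , Cc′) → g-k-at b′ p′ c Cc′ }) (b , p , Cc)

    A≐⋃Ck : A ≐ ⋃ (⋃ B h) k
    A≐⋃Ck w = to , from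
      where
      to : A w → ⋃ (⋃ B h) k w
      to aw with proj₁ (A≐ w) aw
      ... | b , p , mw with proj₁ (m≐ b p w) mw
      ... | c , Cc , kw = c , (b , p , p , Cc) , (b , p , Cc) , kw
      from : ⋃ (⋃ B h) k w → A w
      from (c , _ , (b , p , Cc) , kw) =
        proj₂ (A≐ w) (b , p , proj₂ (m≐ b p w) (c , Cc , kw))

proposition7p5 : {X Y Z W : Set} (α : Rel℘ X Y) (f : Rel℘ Y Z) (g : Rel℘ Z W)
    → IsPfn f → Respects≐ f → IsPfn g → Respects≐ g
    → ((α ✶ f) ✶ g) ≡ᴿ (α ✶ (f ✶ g))
proposition7p5 α f g pf rf pg rg = ⊑-assoc , ⊒-assoc
  where
  ⊑-assoc : ((α ✶ f) ✶ g) ⊑ (α ✶ (f ✶ g))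
  ⊑-assoc x A (C , (B , αB , fBC) , gCA) = B , αB , lift*-compose f g fBC gCA

  ⊒-assoc : (α ✶ (f ✶ g)) ⊑ ((α ✶ f) ✶ g)
  ⊒-assoc x A (B , αB , fgBA) with lift*-split f g pf rf pg rg fgBA
  ... | C , fBC , gCA = C , (B , αB , fBC) , gCA
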